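{- A tree $t$ is a Union-Find tree if and only if $t\vdash^* s$ for some Union tree $s$.
   Context: A tree is $t=(V_t,\mathrm{root}_t,\mathrm{parent}_t)$ with $V_t$ a finite set of nodes, $\mathrm{root}_t\in V_t$, and $\mathrm{parent}_t:V_t\setminus\{\mathrm{root}_t\}\to V_t$ such that iterating $\mathrm{parent}_t$ from any node reaches the root. $x\preceq_t y$ means $x=\mathrm{parent}_t^k(y)$ for some $k\ge0$; $\mathrm{size}(t,x)=|\{y:x\preceq_t y\}|$, $\mathrm{size}(t)=\mathrm{size}(t,\mathrm{root}_t)$. For trees $t,s$ with disjoint node sets, $\textsc{merge}(t,s)$ is the tree on $V_t\cup V_s$ with root $\mathrm{root}_t$, in which $\mathrm{root}_s$ becomes a child of $\mathrm{root}_t$ and all other parents are as in $t$ and $s$. For a node $x$ of $t$, $\textsc{collapse}(t,x)$ is obtained by setting the parent of every non-root ancestor of $x$ (including $x$ itself if not the root) to $\mathrm{root}_t$, all other parents unchanged. Union trees: the least class of trees containing all one-node trees and containing $\textsc{merge}(t,s)$ whenever $t,s$ are in it with $\mathrm{size}(t)\ge\mathrm{size}(s)$. Union-Find trees: the least class containing all one-node trees, closed under $\textsc{merge}(t,s)$ for members with $\mathrm{size}(t)\ge\mathrm{size}(s)$, and closed under $\textsc{collapse}(t,x)$ for any member $t$ and node $x$. For distinct siblings $x\neq y$ in $t$, $\mathrm{push}(t,x,y)$ is the tree with the same nodes and root where the parent of $x$ becomes $y$, all other parents unchanged. $t\vdash t'$ means $t'=\mathrm{push}(t,x,y)$ for some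 such $x,y$; $\vdash^*$ is the reflexive-transitive closure of $\vdash$. -}

module Defs where

open import Data.Nat using (ℕ; zero; suc; _≤_)
open import Data.List using (List; []; _∷_; length)
open import Data.List.Membership.Propositional using (_∈_; _∉_)
open import Data.List.Relation.Unary.Unique.Propositional using (Unique)
open import Data.Product using (Σ; ∃; _×_; _,_)
open import Data.Sum using (_⊎_)
open import Function using (_⇔_)
open import Relation.Nullary using (¬_)
open import Relation.Binary.PropositionalEquality using (_≡_; _≢_)
open import Relation.Binary.Construct.Closure.ReflexiveTransitive using (Star)

iter : (ℕ → ℕ) → ℕ → ℕ → ℕ
iter f zero    x = x
iter f (suc k) x = f (iter f k x)

-- Nodes are drawn from ℕ (so that disjointness of node sets makes sense).
-- The node set is a duplicate-free list; only its membership matters.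
-- `parent` is only meaningful on non-root nodes; its values elsewhere are junk
-- and are ignored by every notion below.
record Tree : Set where
  field
    nodes   : List ℕ
    uniq    : Unique nodes
    root    : ℕ
    root∈   : root ∈ nodes
    parent  : ℕ → ℕ
    parent∈ : ∀ x → x ∈ nodes → x ≢ root → parent x ∈ nodes
    reach   : ∀ x → x ∈ nodes → ∃ λ k → iter parent k x ≡ root
open Tree public

_⪯[_]_ : ℕ → Tree → ℕ → Set
x ⪯[ t ] y = ∃ λ k → iter (parent t) k y ≡ x

-- size(t) = size(t, root_t) = |{ y : root_t ⪯_t y }| = |V_t|,
-- since every node reaches the root.
size : Tree → ℕ
size t = length (nodes t)

OneNode : Tree → Set
OneNode t = length (nodes t) ≡ 1

record IsMerge (t s u : Tree) : Set where
  field
    disjoint  : ∀ x → x ∈ nodes t → x ∉ nodes s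
    nodes-u   : ∀ x → x ∈ nodes u ⇔ (x ∈ nodes t ⊎ x ∈ nodes s)
    root-u    : root u ≡ root t
    parent-rs : parent u (root s) ≡ root t
    parent-t  : ∀ x → x ∈ nodes t → x ≢ root t → parent u x ≡ parent t x
    parent-s  : ∀ x → x ∈ nodes s → x ≢ root s → parent u x ≡ parent s x

record IsCollapse (t : Tree) (x : ℕ) (u : Tree) : Set where
  field
    x∈        : x ∈ nodes t
    nodes-u   : ∀ y → y ∈ nodes u ⇔ y ∈ nodes t
    root-u    : root u ≡ root t
    parent-anc    : ∀ y → y ∈ nodes t → y ≢ root t → y ⪯[ t ] x → parent u y ≡ root t
    parent-nonanc : ∀ y → y ∈ nodes t → y ≢ root t → ¬ (y ⪯[ t ] x) → parent u y ≡ parent t y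

record IsPush (t : Tree) (x y : ℕ) (u : Tree) : Set where
  field
    x≢y      : x ≢ y
    x∈       : x ∈ nodes t
    y∈       : y ∈ nodes t
    x≢root   : x ≢ root t
    y≢root   : y ≢ root t
    sibling  : parent t x ≡ parent t y
    nodes-u  : ∀ z → z ∈ nodes u ⇔ z ∈ nodes t
    root-u   : root u ≡ root t
    parent-x : parent u x ≡ y
    parent-other : ∀ z → z ∈ nodes t → z ≢ root t → z ≢ x → parent u z ≡ parent t z

_⊢_ : Tree → Tree → Set
t ⊢ t′ = ∃ λ x → ∃ λ y → IsPush t x y t′

_⊢*_ : Tree → Tree → Set
_⊢*_ = Star _⊢_

data UnionTree : Tree → Set where
  one   : ∀ {t} → OneNode t → UnionTree t
  merge : ∀ {t s u} → UnionTree t → UnionTree s → size s ≤ size t →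
          IsMerge t s u → UnionTree u

data UnionFindTree : Tree → Set where
  one      : ∀ {t} → OneNode t → UnionFindTree t
  merge    : ∀ {t s u} → UnionFindTree t → UnionFindTree s → size s ≤ size t →
             IsMerge t s u → UnionFindTree u
  collapse : ∀ {t x u} → UnionFindTree t → IsCollapse t x u → UnionFindTree u

-- Both directions pass through the shortcut order:  t ⊑ s  when t and s have
-- the same nodes and root and every t-parent is a strict s-ancestor.
--  (⇐) Undoing a push keeps ⊑, so t ⊢* s gives t ⊑ s.  Every t ⊑ s with s a
--      Union tree is Union-Find, by induction on s = merge(a, b): t is the
--      merge of its restrictions to a and b, except for b-nodes attached
--      directly to the root of a, and each of these is one collapse away
--      from a tree attaching it to the root of b instead.
--  (⇒) Every Union-Find tree t is below some Union tree s (merges are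
--      mirrored, collapses stay below).  While t differs from s, some node
--      can be pushed to a sibling lying on its s-path up to its t-parent;
--      this decreases the total s-distance from nodes to their t-parents,
--      so t is pushed to a tree agreeing with s, again a Union tree.
module Submission where

open import Defs
open import Data.Nat using (ℕ; zero; suc; _+_; _≤_; _<_; z≤n; s≤s; _≟_)
open import Data.Nat.Properties
  using (≤-reflexive; <⇒≤; m<n⇒m<1+n; n<1+n; +-mono-≤; +-mono-<-≤; +-mono-≤-<)
open import Data.Nat.Induction using (<-wellFounded)
open import Data.Nat.ListAction using (sum)
open import Data.List using (List; []; _∷_; _++_; map)
open import Data.List.Membership.Propositional using (_∈_; _∉_; find; lose)
open import Data.List.Membership.Propositional.Properties using (∈-++⁺ˡ; ∈-++⁺ʳ; ∈-++⁻)
open import Data.List.Membership.DecPropositional _≟_ using (_∈?_)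
open import Data.List.Relation.Unary.Any using (here; there; any?)
open import Data.List.Relation.Unary.Unique.Propositional using (Unique)
import Data.List.Relation.Unary.Unique.Propositional.Properties as Unique
open import Data.List.Membership.Propositional.Properties.WithK using (unique∧set⇒bag)
open import Data.List.Relation.Binary.BagAndSetEquality using (∼bag⇒↭)
open import Data.List.Relation.Binary.Permutation.Propositional.Properties using (↭-length)
open import Data.Product using (Σ; ∃; ∃₂; _×_; _,_; proj₁; proj₂; map₂)
open import Data.Sum using (_⊎_; inj₁; inj₂; [_,_]′)
import Data.Sum as Sum
open import Data.Empty using (⊥-elim)
open import Function using (_⇔_; mk⇔; Equivalence)
open import Induction.WellFounded using (Acc; acc)
open import Relation.Nullary using (¬_; Dec; yes; no)
open import Relation.Nullary.Decidable using (¬?; _×-dec_; decidable-stable)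
open import Relation.Binary.PropositionalEquality
open import Relation.Binary.Construct.Closure.ReflexiveTransitive using (ε; _◅_)

open Equivalence using (to; from)

iter-shift : ∀ f k x → iter f (suc k) x ≡ iter f k (f x)
iter-shift f zero    x = refl
iter-shift f (suc k) x = cong f (iter-shift f k x)

-- Path f r n p x : n ≥ 1 steps of f lead from x to p, and no step departs
-- from r.  For the parent function of a tree with root r this says that p is
-- a strict ancestor of x at distance n.
data Path (f : ℕ → ℕ) (r : ℕ) : ℕ → ℕ → ℕ → Set where
  step : ∀ {x} → x ≢ r → Path f r 1 (f x) x
  _▸_  : ∀ {n p x} → x ≢ r → Path f r n p (f x) → Path f r (suc n) p x

infixr 5 _▸_

module _ {f : ℕ → ℕ} {r : ℕ} where

  path-start : ∀ {n p x} → Path f r n p x → x ≢ r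
  path-start (step x≢r) = x≢r
  path-start (x≢r ▸ _)  = x≢r

  path-pos : ∀ {n p x} → Path f r n p x → 1 ≤ n
  path-pos (step _) = s≤s z≤n
  path-pos (_ ▸ _)  = s≤s z≤n

  path-iter : ∀ {n p x} → Path f r n p x → iter f n x ≡ p
  path-iter (step _) = refl
  path-iter {suc n} {x = x} (_ ▸ q) = trans (iter-shift f n x) (path-iter q)

  infixr 5 _++ₚ_
  _++ₚ_ : ∀ {n m p q x} → Path f r n p x → Path f r m q p → Path f r (n + m) q x
  step x≢r   ++ₚ q = x≢r ▸ q
  (x≢r ▸ p) ++ₚ q = x≢r ▸ (p ++ₚ q)

  lastStep : ∀ {n p x} → Path f r n p x →
             p ≡ f x ⊎ ∃₂ λ m c → m < n × Path f r m c x × c ≢ r × f c ≡ p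
  lastStep (step _) = inj₁ refl
  lastStep (x≢r ▸ q) with lastStep q
  ... | inj₁ p≡ffx = inj₂ (1 , _ , s≤s (path-pos q) , step x≢r , path-start q , sym p≡ffx)
  ... | inj₂ (m , c , m<n , qc , c≢r , fc≡p) = inj₂ (suc m , c , s≤s m<n , x≢r ▸ qc , c≢r , fc≡p)

  locate : ∀ {n d y z x} → Path f r n y x → Path f r d z x → z ≡ r →
           y ≡ r ⊎ ∃ λ m → m < d × Path f r m z y
  locate (step _)  (step _)  z≡r = inj₁ z≡r
  locate (step _)  (_ ▸ q′)  _   = inj₂ (_ , n<1+n _ , q′)
  locate (_ ▸ q)   (step _)  z≡r = ⊥-elim (path-start q z≡r)
  locate (_ ▸ q)   (_ ▸ q′)  z≡r with locate q q′ z≡r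
  ... | inj₁ y≡r = inj₁ y≡r
  ... | inj₂ (m , m<d , p) = inj₂ (m , m<n⇒m<1+n m<d , p)

path-dec : ∀ {f r d y} → Path f r d r y → (p : ℕ) → Dec (∃ λ n → Path f r n p y)
path-dec {f} {y = y} (step y≢r) p with p ≟ f y
... | yes refl = yes (1 , step y≢r)
... | no p≢fy  = no λ { (_ , step _) → p≢fy refl ; (_ , _ ▸ q) → path-start q refl }
path-dec {f} {y = y} (y≢r ▸ rp) p with p ≟ f y
... | yes refl = yes (1 , step y≢r)
... | no p≢fy with path-dec rp p
...   | yes (n , q) = yes (suc n , y≢r ▸ q)
...   | no ¬above   = no λ { (_ , step _) → p≢fy refl ; (_ , _ ▸ q) → ¬above (_ , q) }

transfer : ∀ {f g r r′} (P : ℕ → Set) →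
           (∀ z → P z → z ≢ r → z ≢ r′ × g z ≡ f z × P (f z)) →
           ∀ {n p x} → P x → Path f r n p x → Path g r′ n p x
transfer {g = g} {r′ = r′} P closed {x = x} Px (step x≢r) with closed x Px x≢r
... | x≢r′ , gx≡fx , _ = subst (λ q → Path g r′ 1 q x) gx≡fx (step x≢r′)
transfer {g = g} {r′ = r′} P closed {suc n} {p} {x} Px (x≢r ▸ q) with closed x Px x≢r
... | x≢r′ , gx≡fx , Pfx =
  x≢r′ ▸ subst (λ y → Path g r′ n p y) (sym gx≡fx) (transfer P closed Pfx q)

PathT : Tree → ℕ → ℕ → ℕ → Set
PathT T = Path (parent T) (root T)

StrictAnc : Tree → ℕ → ℕ → Set
StrictAnc T y x = ∃ λ n → PathT T n y x

syntax StrictAnc T y x = y ⊏[ T ] x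

module _ (T : Tree) where

  path-end∈ : ∀ {n p x} → PathT T n p x → x ∈ nodes T → p ∈ nodes T
  path-end∈ (step x≢r) x∈ = parent∈ T _ x∈ x≢r
  path-end∈ (x≢r ▸ q)  x∈ = path-end∈ q (parent∈ T _ x∈ x≢r)

  rootPath : ∀ {x} → x ∈ nodes T → x ≡ root T ⊎ ∃ λ n → PathT T n (root T) x
  rootPath {x} x∈ = walk (proj₁ (reach T x x∈)) x∈ (proj₂ (reach T x x∈))
    where
    walk : ∀ k {y} → y ∈ nodes T → iter (parent T) k y ≡ root T →
           y ≡ root T ⊎ ∃ λ n → PathT T n (root T) y
    walk zero _ y≡r = inj₁ y≡r
    walk (suc k) {y} y∈ reached with y ≟ root T
    ... | yes y≡r = inj₁ y≡r
    ... | no y≢r with walk k (parent∈ T y y∈ y≢r) (trans (sym (iter-shift (parent T) k y)) reached)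
    ...   | inj₁ py≡r = inj₂ (1 , subst (λ q → PathT T 1 q y) py≡r (step y≢r))
    ...   | inj₂ (n , q) = inj₂ (suc n , y≢r ▸ q)

  root⊏ : ∀ {x} → x ∈ nodes T → x ≢ root T → root T ⊏[ T ] x
  root⊏ x∈ x≢r = [ (λ x≡r → ⊥-elim (x≢r x≡r)) , (λ rp → rp) ]′ (rootPath x∈)

  -- Strict ancestry is well founded on the nodes: recursion may climb
  -- the tree.  (The depth decreases, by `locate`.)
  ⊏-acc : ∀ {x} → x ∈ nodes T → Acc (StrictAnc T) x
  ⊏-acc x∈ = [ (λ x≡r → subst (Acc (StrictAnc T)) (sym x≡r) root-acc)
             , (λ (d , rp) → depth-acc (<-wellFounded d) rp) ]′ (rootPath x∈)
    where
    root-acc : Acc (StrictAnc T) (root T)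
    root-acc = acc λ (_ , q) → ⊥-elim (path-start q refl)
    depth-acc : ∀ {d x} → Acc _<_ d → PathT T d (root T) x → Acc (StrictAnc T) x
    depth-acc (acc smaller) rp = acc λ (_ , q) →
      [ (λ y≡r → subst (Acc (StrictAnc T)) (sym y≡r) root-acc)
      , (λ (m , m<d , rp′) → depth-acc (smaller m<d) rp′) ]′ (locate q rp refl)

  acyclic : ∀ {x} → x ∈ nodes T → ¬ (x ⊏[ T ] x)
  acyclic x∈ = irreflexive (⊏-acc x∈)
    where
    irreflexive : ∀ {x} → Acc (StrictAnc T) x → ¬ (x ⊏[ T ] x)
    irreflexive (acc above) cycle = irreflexive (above cycle) cycle

  path-length-unique : ∀ {n m p x} → PathT T n p x → PathT T m p x → x ∈ nodes T → n ≡ m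
  path-length-unique (step _)  (step _)   _  = refl
  path-length-unique (step x≢r) (_ ▸ q)   x∈ = ⊥-elim (acyclic (parent∈ T _ x∈ x≢r) (_ , q))
  path-length-unique (x≢r ▸ q) (step _)   x∈ = ⊥-elim (acyclic (parent∈ T _ x∈ x≢r) (_ , q))
  path-length-unique (x≢r ▸ q) (_ ▸ q′)   x∈ =
    cong suc (path-length-unique q q′ (parent∈ T _ x∈ x≢r))

  ⊏-dec : ∀ {y} → y ∈ nodes T → y ≢ root T → (p : ℕ) → Dec (p ⊏[ T ] y)
  ⊏-dec y∈ y≢r = path-dec (proj₂ (root⊏ y∈ y≢r))

mkTree : (L : List ℕ) → Unique L → (r : ℕ) → r ∈ L → (g : ℕ → ℕ) →
         (∀ x → x ∈ L → x ≢ r → g x ∈ L) →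
         (∀ x → x ∈ L → x ≡ r ⊎ ∃ λ n → Path g r n r x) → Tree
mkTree L L-unique r r∈ g g∈ toRoot = record
  { nodes = L ; uniq = L-unique ; root = r ; root∈ = r∈ ; parent = g ; parent∈ = g∈
  ; reach = λ x x∈ → [ (λ x≡r → 0 , x≡r) , (λ (n , q) → n , path-iter q) ]′ (toRoot x x∈) }

-- f with r turned into a fixed point.  Shortcut trees use it so that
-- iterating the parent function never leaves the tree above the root.
fixRoot : ℕ → (ℕ → ℕ) → ℕ → ℕ
fixRoot r f y with y ≟ r
... | yes _ = r
... | no _  = f y

fixRoot-root : ∀ r f → fixRoot r f r ≡ r
fixRoot-root r f with r ≟ r
... | yes _   = refl
... | no r≢r = ⊥-elim (r≢r refl)

fixRoot-other : ∀ r f {y} → y ≢ r → fixRoot r f y ≡ f y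
fixRoot-other r f {y} y≢r with y ≟ r
... | yes y≡r = ⊥-elim (y≢r y≡r)
... | no _    = refl

Shortcut : Tree → (ℕ → ℕ) → Set
Shortcut s f = ∀ x → x ∈ nodes s → x ≢ root s → f x ⊏[ s ] x

shortcutTree : (s : Tree) (f : ℕ → ℕ) → Shortcut s f → Tree
shortcutTree s f sc =
  mkTree (nodes s) (uniq s) r (root∈ s) g
         (λ x x∈ x≢r → subst (_∈ nodes s) (sym (fixRoot-other r f x≢r))
                             (path-end∈ s (proj₂ (sc x x∈ x≢r)) x∈))
         (λ x x∈ → climb (⊏-acc s x∈) x∈)
  where
  r : ℕ
  r = root s
  g : ℕ → ℕ
  g = fixRoot r f
  climb : ∀ {x} → Acc (StrictAnc s) x → x ∈ nodes s → x ≡ r ⊎ ∃ λ n → Path g r n r x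
  climb {x} (acc above) x∈ with x ≟ r
  ... | yes x≡r = inj₁ x≡r
  ... | no x≢r with climb (above (sc x x∈ x≢r)) (path-end∈ s (proj₂ (sc x x∈ x≢r)) x∈)
  ...   | inj₁ fx≡r    = inj₂ (1 , subst (λ q → Path g r 1 q x)
                                         (trans (fixRoot-other r f x≢r) fx≡r) (step x≢r))
  ...   | inj₂ (n , q) = inj₂ (suc n , x≢r ▸ subst (λ y → Path g r n r y)
                                                   (sym (fixRoot-other r f x≢r)) q)

module MergePaths {a b s : Tree} (m : IsMerge a b s) where
  open IsMerge m

  inA : ∀ {x} → x ∈ nodes a → x ∈ nodes s
  inA {x} x∈ = from (nodes-u x) (inj₁ x∈)

  inB : ∀ {x} → x ∈ nodes b → x ∈ nodes s
  inB {x} x∈ = from (nodes-u x) (inj₂ x∈)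

  b≢root : ∀ {x} → x ∈ nodes b → x ≢ root s
  b≢root x∈ x≡r = disjoint (root a) (root∈ a) (subst (_∈ nodes b) (trans x≡r root-u) x∈)

  rb≢ra : root b ≢ root a
  rb≢ra rb≡ra = b≢root (root∈ b) (trans rb≡ra (sym root-u))

  into-a : ∀ {n p x} → x ∈ nodes a → PathT a n p x → PathT s n p x
  into-a = transfer (_∈ nodes a) λ z z∈ z≢r →
    (λ z≡r → z≢r (trans z≡r root-u)) , parent-t z z∈ z≢r , parent∈ a z z∈ z≢r

  into-b : ∀ {n p x} → x ∈ nodes b → PathT b n p x → PathT s n p x
  into-b = transfer (_∈ nodes b) λ z z∈ z≢r →
    b≢root z∈ , parent-s z z∈ z≢r , parent∈ b z z∈ z≢r

  from-a : ∀ {n p x} → x ∈ nodes a → PathT s n p x → PathT a n p x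
  from-a = transfer (_∈ nodes a) λ z z∈ z≢r →
    let z≢ra = λ z≡ra → z≢r (trans z≡ra (sym root-u))
        pz≡  = parent-t z z∈ z≢ra
    in z≢ra , sym pz≡ , subst (_∈ nodes a) (sym pz≡) (parent∈ a z z∈ z≢ra)

  from-b : ∀ {n p x} → x ∈ nodes b → PathT s n p x → PathT b n p x ⊎ p ≡ root a
  from-b {x = x} x∈ q with x ≟ root b
  from-b x∈ (step _)   | yes refl = inj₂ parent-rs
  from-b x∈ (_ ▸ q)    | yes refl = ⊥-elim (path-start q (trans parent-rs (sym root-u)))
  from-b {x = x} x∈ (step _) | no x≢rb =
    inj₁ (subst (λ q → PathT b 1 q x) (sym (parent-s x x∈ x≢rb)) (step x≢rb))
  from-b {x = x} x∈ (_ ▸ q)  | no x≢rb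
    with from-b (subst (_∈ nodes b) (sym (parent-s x x∈ x≢rb)) (parent∈ b x x∈ x≢rb)) q
  ... | inj₁ qb    = inj₁ (x≢rb ▸ subst (λ y → PathT b _ _ y) (parent-s x x∈ x≢rb) qb)
  ... | inj₂ p≡ra = inj₂ p≡ra

  above-rb : ∀ {n p} → PathT s n p (root b) → p ≡ root a
  above-rb q = [ (λ qb → ⊥-elim (path-start qb refl)) , (λ p≡ra → p≡ra) ]′ (from-b (root∈ b) q)

module MergeConstruction (a b : Tree) (disjoint : ∀ x → x ∈ nodes a → x ∉ nodes b) where

  ra rb : ℕ
  ra = root a
  rb = root b

  g : ℕ → ℕ
  g x with x ≟ rb | x ∈? nodes a
  ... | yes _ | _     = ra
  ... | no _  | yes _ = parent a x
  ... | no _  | no _  = parent b x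

  a≢rb : ∀ {x} → x ∈ nodes a → x ≢ rb
  a≢rb x∈ x≡rb = disjoint _ x∈ (subst (_∈ nodes b) (sym x≡rb) (root∈ b))

  b≢ra : ∀ {x} → x ∈ nodes b → x ≢ ra
  b≢ra x∈ x≡ra = disjoint _ (root∈ a) (subst (_∈ nodes b) x≡ra x∈)

  g-rb : g rb ≡ ra
  g-rb with rb ≟ rb
  ... | yes _     = refl
  ... | no rb≢rb = ⊥-elim (rb≢rb refl)

  g-a : ∀ x → x ∈ nodes a → x ≢ ra → g x ≡ parent a x
  g-a x x∈ _ with x ≟ rb | x ∈? nodes a
  ... | yes x≡rb | _     = ⊥-elim (a≢rb x∈ x≡rb)
  ... | no _     | yes _ = refl
  ... | no _     | no x∉ = ⊥-elim (x∉ x∈)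

  g-b : ∀ x → x ∈ nodes b → x ≢ rb → g x ≡ parent b x
  g-b x x∈ x≢rb with x ≟ rb | x ∈? nodes a
  ... | yes x≡rb | _      = ⊥-elim (x≢rb x≡rb)
  ... | no _     | yes x∈a = ⊥-elim (disjoint x x∈a x∈)
  ... | no _     | no _    = refl

  L : List ℕ
  L = nodes a ++ nodes b

  g∈ : ∀ x → x ∈ L → x ≢ ra → g x ∈ L
  g∈ x x∈ x≢ra with ∈-++⁻ (nodes a) x∈
  ... | inj₁ x∈a = ∈-++⁺ˡ (subst (_∈ nodes a) (sym (g-a x x∈a x≢ra)) (parent∈ a x x∈a x≢ra))
  ... | inj₂ x∈b = b-case (x ≟ rb)
    where
    b-case : Dec (x ≡ rb) → g x ∈ L
    b-case (yes x≡rb) = ∈-++⁺ˡ (subst (_∈ nodes a) (sym (trans (cong g x≡rb) g-rb)) (root∈ a))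
    b-case (no x≢rb)  = ∈-++⁺ʳ (nodes a) (subst (_∈ nodes b) (sym (g-b x x∈b x≢rb))
                                                 (parent∈ b x x∈b x≢rb))

  path-a : ∀ {n p x} → x ∈ nodes a → PathT a n p x → Path g ra n p x
  path-a = transfer (_∈ nodes a) λ z z∈ z≢ra → z≢ra , g-a z z∈ z≢ra , parent∈ a z z∈ z≢ra

  path-b : ∀ {n p x} → x ∈ nodes b → PathT b n p x → Path g ra n p x
  path-b = transfer (_∈ nodes b) λ z z∈ z≢rb → b≢ra z∈ , g-b z z∈ z≢rb , parent∈ b z z∈ z≢rb

  rb→ra : Path g ra 1 ra rb
  rb→ra = subst (λ q → Path g ra 1 q rb) g-rb (step (b≢ra (root∈ b)))

  toRoot : ∀ x → x ∈ L → x ≡ ra ⊎ ∃ λ n → Path g ra n ra x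
  toRoot x x∈ with ∈-++⁻ (nodes a) x∈
  ... | inj₁ x∈a = [ inj₁ , (λ (n , q) → inj₂ (n , path-a x∈a q)) ]′ (rootPath a x∈a)
  ... | inj₂ x∈b = inj₂ ([ (λ { refl → 1 , rb→ra })
                          , (λ (n , q) → n + 1 , path-b x∈b q ++ₚ rb→ra) ]′ (rootPath b x∈b))

  merged : Tree
  merged = mkTree L (Unique.++⁺ (uniq a) (uniq b) (λ (x∈a , x∈b) → disjoint _ x∈a x∈b))
                  ra (∈-++⁺ˡ (root∈ a)) g g∈ toRoot

  is-merge : IsMerge a b merged
  is-merge = record
    { disjoint = disjoint ; nodes-u = λ x → mk⇔ (∈-++⁻ (nodes a)) [ ∈-++⁺ˡ , ∈-++⁺ʳ (nodes a) ]′
    ; root-u = refl ; parent-rs = g-rb ; parent-t = g-a ; parent-s = g-b }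

record _⊑_ (t s : Tree) : Set where
  field
    same-nodes : ∀ z → z ∈ nodes t ⇔ z ∈ nodes s
    same-root  : root t ≡ root s
    shortcut   : Shortcut s (parent t)
open _⊑_ public

-- Related trees have the same size (their node lists are duplicate-free).
⊑-size : ∀ {t s} → t ⊑ s → size t ≡ size s
⊑-size {t} {s} R =
  ↭-length (∼bag⇒↭ (unique∧set⇒bag (uniq t) (uniq s) (λ {z} → same-nodes R z)))

⊏-trans : ∀ {s p y x} → p ⊏[ s ] y → y ⊏[ s ] x → p ⊏[ s ] x
⊏-trans (n , q) (m , q′) = m + n , q′ ++ₚ q

⊏-subst : ∀ {s p p′ x} → p ≡ p′ → p ⊏[ s ] x → p′ ⊏[ s ] x
⊏-subst {s} {x = x} = subst (λ p → p ⊏[ s ] x)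

⊑-refl : ∀ {s} → s ⊑ s
⊑-refl = record
  { same-nodes = λ _ → mk⇔ (λ z∈ → z∈) (λ z∈ → z∈) ; same-root = refl
  ; shortcut = λ _ _ x≢r → 1 , step x≢r }

shortcutTree-⊑ : ∀ s f sc → shortcutTree s f sc ⊑ s
shortcutTree-⊑ s f sc = record
  { same-nodes = λ _ → mk⇔ (λ z∈ → z∈) (λ z∈ → z∈) ; same-root = refl
  ; shortcut = λ x x∈ x≢r → ⊏-subst {s} (sym (fixRoot-other (root s) f x≢r)) (sc x x∈ x≢r) }

-- Undoing a push stays below s: the pushed node x gets back the parent of
-- its sibling y, which is an s-ancestor of y and so of x.
⊑-push : ∀ {t t₁ s} → t ⊢ t₁ → t₁ ⊑ s → t ⊑ s
⊑-push {t} {t₁} {s} (x , y , P) R = record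
  { same-nodes = λ z → mk⇔ (λ z∈ → to (same-nodes R z) (from (P.nodes-u z) z∈))
                           (λ z∈ → to (P.nodes-u z) (from (same-nodes R z) z∈))
  ; same-root  = trans (sym P.root-u) (same-root R)
  ; shortcut   = shortcut-t }
  where
  module P = IsPush P
  root-t : root t ≡ root s
  root-t = trans (sym P.root-u) (same-root R)
  shortcut-t : Shortcut s (parent t)
  shortcut-t z z∈ z≢r with z ≟ x
  ... | yes z≡x =
    subst (λ w → parent t w ⊏[ s ] w) (sym z≡x) (⊏-subst {s} py≡px (⊏-trans {s} py⊏y y⊏x))
    where
    x∈ : x ∈ nodes s
    x∈ = to (same-nodes R x) (from (P.nodes-u x) P.x∈)
    y∈ : y ∈ nodes s
    y∈ = to (same-nodes R y) (from (P.nodes-u y) P.y∈)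
    y⊏x : y ⊏[ s ] x
    y⊏x = ⊏-subst {s} P.parent-x (shortcut R x x∈ (λ x≡r → P.x≢root (trans x≡r (sym root-t))))
    py⊏y : parent t₁ y ⊏[ s ] y
    py⊏y = shortcut R y y∈ (λ y≡r → P.y≢root (trans y≡r (sym root-t)))
    py≡px : parent t₁ y ≡ parent t x
    py≡px = trans (P.parent-other y P.y∈ P.y≢root (λ y≡x → P.x≢y (sym y≡x))) (sym P.sibling)
  ... | no z≢x = ⊏-subst {s} (P.parent-other z (to (P.nodes-u z) (from (same-nodes R z) z∈))
                                           (λ z≡rt → z≢r (trans z≡rt root-t)) z≢x)
                         (shortcut R z z∈ z≢r)

⊢*-⊑ : ∀ {t t₁ s} → t ⊢* t₁ → t₁ ⊑ s → t ⊑ s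
⊢*-⊑ ε            R = R
⊢*-⊑ (push ◅ rest) R = ⊑-push push (⊢*-⊑ rest R)

-- Collapsing stays below s: every node keeps its parent or gets the root.
-- Whether a node is an ancestor of the collapsed one is not decidable in
-- general, but being a strict s-ancestor is, so we argue by contradiction.
⊑-collapse : ∀ {t x u s} → IsCollapse t x u → t ⊑ s → u ⊑ s
⊑-collapse {t} {x} {u} {s} C R = record
  { same-nodes = λ z → mk⇔ (λ z∈ → to (same-nodes R z) (to (C.nodes-u z) z∈))
                           (λ z∈ → from (C.nodes-u z) (from (same-nodes R z) z∈))
  ; same-root  = trans C.root-u (same-root R)
  ; shortcut   = shortcut-u }
  where
  module C = IsCollapse C
  shortcut-u : Shortcut s (parent u)
  shortcut-u z z∈ z≢r with ⊏-dec s z∈ z≢r (parent u z)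
  ... | yes above = above
  ... | no ¬above = ⊥-elim (¬above (⊏-subst {s} (sym (C.parent-nonanc z z∈t z≢rt ¬anc))
                                            (shortcut R z z∈ z≢r)))
    where
    z∈t : z ∈ nodes t
    z∈t = from (same-nodes R z) z∈
    z≢rt : z ≢ root t
    z≢rt z≡rt = z≢r (trans z≡rt (same-root R))
    ¬anc : ¬ (z ⪯[ t ] x)
    ¬anc anc = ¬above (⊏-subst {s} (sym (trans (C.parent-anc z z∈t z≢rt anc) (same-root R)))
                               (root⊏ s z∈ z≢r))

⊑-merge : ∀ {a b u a′ b′ s} → IsMerge a b u → IsMerge a′ b′ s → a ⊑ a′ → b ⊑ b′ → u ⊑ s
⊑-merge {a} {b} {u} {a′} {b′} {s} M S Ra Rb = record
  { same-nodes = λ z → mk⇔ (λ z∈ → from (S.nodes-u z) (to (parts z) (to (M.nodes-u z) z∈)))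
                           (λ z∈ → from (M.nodes-u z) (from (parts z) (to (S.nodes-u z) z∈)))
  ; same-root  = root-u
  ; shortcut   = shortcut-u }
  where
  module M = IsMerge M
  module S = IsMerge S
  parts : ∀ z → (z ∈ nodes a ⊎ z ∈ nodes b) ⇔ (z ∈ nodes a′ ⊎ z ∈ nodes b′)
  parts z = mk⇔ (Sum.map (to (same-nodes Ra z)) (to (same-nodes Rb z)))
                (Sum.map (from (same-nodes Ra z)) (from (same-nodes Rb z)))
  root-u : root u ≡ root s
  root-u = trans M.root-u (trans (same-root Ra) (sym S.root-u))
  shortcut-u : Shortcut s (parent u)
  shortcut-u z z∈ z≢r with to (S.nodes-u z) z∈
  ... | inj₁ z∈a′ = ⊏-subst {s} (sym (M.parent-t z (from (same-nodes Ra z) z∈a′) z≢ra))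
                           (map₂ (MergePaths.into-a S z∈a′) (shortcut Ra z z∈a′ z≢ra′))
    where
    z≢ra′ : z ≢ root a′
    z≢ra′ z≡ra′ = z≢r (trans z≡ra′ (sym S.root-u))
    z≢ra : z ≢ root a
    z≢ra z≡ra = z≢ra′ (trans z≡ra (same-root Ra))
  ... | inj₂ z∈b′ with z ≟ root b
  ...   | yes z≡rb = ⊏-subst {s} (sym pz≡r) (root⊏ s z∈ z≢r)
    where
    pz≡r : parent u z ≡ root s
    pz≡r = trans (cong (parent u) z≡rb) (trans M.parent-rs (trans (sym M.root-u) root-u))
  ...   | no z≢rb  = ⊏-subst {s} (sym (M.parent-s z (from (same-nodes Rb z) z∈b′) z≢rb))
                             (map₂ (MergePaths.into-b S z∈b′) (shortcut Rb z z∈b′ z≢rb′))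
    where
    z≢rb′ : z ≢ root b′
    z≢rb′ z≡rb′ = z≢rb (trans z≡rb′ (sym (same-root Rb)))

module Redirect {t s : Tree} (R : t ⊑ s) (x v : ℕ) (v⊏x : v ⊏[ s ] x) where

  f : ℕ → ℕ
  f z with z ≟ x
  ... | yes _ = v
  ... | no _  = parent t z

  f-shortcut : Shortcut s f
  f-shortcut z z∈ z≢r with z ≟ x
  ... | yes z≡x = subst (λ w → v ⊏[ s ] w) (sym z≡x) v⊏x
  ... | no _    = shortcut R z z∈ z≢r

  tree : Tree
  tree = shortcutTree s f f-shortcut

  tree-⊑ : tree ⊑ s
  tree-⊑ = shortcutTree-⊑ s f f-shortcut

  parent-x : x ≢ root s → parent tree x ≡ v
  parent-x x≢r = trans (fixRoot-other (root s) f x≢r) f-x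
    where
    f-x : f x ≡ v
    f-x with x ≟ x
    ... | yes _   = refl
    ... | no x≢x = ⊥-elim (x≢x refl)

  parent-other : ∀ {z} → z ≢ root s → z ≢ x → parent tree z ≡ parent t z
  parent-other {z} z≢r z≢x = trans (fixRoot-other (root s) f z≢r) f-z
    where
    f-z : f z ≡ parent t z
    f-z with z ≟ x
    ... | yes z≡x = ⊥-elim (z≢x z≡x)
    ... | no _    = refl

  parent-root : parent tree (root s) ≡ root s
  parent-root = fixRoot-root (root s) f

iterates-of-grandchild : ∀ {g y c r} → g y ≡ c → g c ≡ r → g r ≡ r →
                         ∀ k → iter g k y ≡ y ⊎ iter g k y ≡ c ⊎ iter g k y ≡ r
iterates-of-grandchild gy≡c gc≡r gr≡r zero = inj₁ refl
iterates-of-grandchild {g} gy≡c gc≡r gr≡r (suc k) with iterates-of-grandchild gy≡c gc≡r gr≡r k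
... | inj₁ at-y         = inj₂ (inj₁ (trans (cong g at-y) gy≡c))
... | inj₂ (inj₁ at-c) = inj₂ (inj₂ (trans (cong g at-c) gc≡r))
... | inj₂ (inj₂ at-r) = inj₂ (inj₂ (trans (cong g at-r) gr≡r))

module MergeStep {a b s : Tree} (M : IsMerge a b s) (b≤a : size b ≤ size a)
                 (IH-a : ∀ {t} → t ⊑ a → UnionFindTree t)
                 (IH-b : ∀ {t} → t ⊑ b → UnionFindTree t) where
  open IsMerge M
  open MergePaths M

  ra rb : ℕ
  ra = root a
  rb = root b

  Bad : Tree → ℕ → Set
  Bad t x = x ∈ nodes b × x ≢ rb × parent t x ≡ ra

  bad? : ∀ t x → Dec (Bad t x)
  bad? t x = (x ∈? nodes b) ×-dec ¬? (x ≟ rb) ×-dec (parent t x ≟ ra)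

  rb⊏ : ∀ {y} → y ∈ nodes b → y ≢ rb → rb ⊏[ s ] y
  rb⊏ y∈ y≢rb = map₂ (into-b y∈) (root⊏ b y∈ y≢rb)

  module _ {t : Tree} (R : t ⊑ s) where

    parent-rb : parent t rb ≡ ra
    parent-rb = above-rb (proj₂ (shortcut R rb (inB (root∈ b)) (b≢root (root∈ b))))

    shortcut-a : Shortcut a (parent t)
    shortcut-a x x∈ x≢ra =
      map₂ (from-a x∈) (shortcut R x (inA x∈) (λ x≡r → x≢ra (trans x≡r root-u)))

    shortcut-b : (∀ x → ¬ Bad t x) → Shortcut b (parent t)
    shortcut-b good x x∈ x≢rb with shortcut R x (inB x∈) (b≢root x∈)
    ... | n , q = [ (λ qb → n , qb) , (λ px≡ra → ⊥-elim (good x (x∈ , x≢rb , px≡ra))) ]′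
                  (from-b x∈ q)

    as-merge : (good : ∀ x → ¬ Bad t x) →
               IsMerge (shortcutTree a (parent t) shortcut-a)
                       (shortcutTree b (parent t) (shortcut-b good)) t
    as-merge good = record
      { disjoint  = disjoint
      ; nodes-u   = λ x → mk⇔ (λ x∈ → to (nodes-u x) (to (same-nodes R x) x∈))
                              (λ x∈ → from (same-nodes R x) (from (nodes-u x) x∈))
      ; root-u    = trans (same-root R) root-u
      ; parent-rs = parent-rb
      ; parent-t  = λ x _ x≢ra → sym (fixRoot-other ra (parent t) x≢ra)
      ; parent-s  = λ x _ x≢rb → sym (fixRoot-other rb (parent t) x≢rb) }

    -- A bad node y is collapsed from the tree that sends y to the root of b
    -- instead: there y's ancestors are y, the root of b and the root.
    module BadNode {y : ℕ} (bad : Bad t y) where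
      y∈ : y ∈ nodes b
      y∈ = proj₁ bad
      y≢rb : y ≢ rb
      y≢rb = proj₁ (proj₂ bad)
      open Redirect R y rb (rb⊏ y∈ y≢rb) public

      collapse-bad : IsCollapse tree y t
      collapse-bad = record
        { x∈ = inB y∈ ; nodes-u = same-nodes R ; root-u = same-root R
        ; parent-anc = ancestor-to-root ; parent-nonanc = other-unchanged }
        where
        ra≡r : ra ≡ root s
        ra≡r = sym root-u
        rb≢y : rb ≢ y
        rb≢y rb≡y = y≢rb (sym rb≡y)
        ancestor-to-root : ∀ z → z ∈ nodes s → z ≢ root s → z ⪯[ tree ] y → parent t z ≡ root s
        ancestor-to-root z _ z≢r (k , yk≡z)
          with iterates-of-grandchild (parent-x (b≢root y∈))
                 (trans (parent-other (b≢root (root∈ b)) rb≢y) (trans parent-rb ra≡r))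
                 parent-root k
        ... | inj₁ at-y         = trans (cong (parent t) (trans (sym yk≡z) at-y))
                                        (trans (proj₂ (proj₂ bad)) ra≡r)
        ... | inj₂ (inj₁ at-rb) = trans (cong (parent t) (trans (sym yk≡z) at-rb))
                                        (trans parent-rb ra≡r)
        ... | inj₂ (inj₂ at-r)  = ⊥-elim (z≢r (trans (sym yk≡z) at-r))
        other-unchanged : ∀ z → z ∈ nodes s → z ≢ root s → ¬ (z ⪯[ tree ] y) →
                          parent t z ≡ parent tree z
        other-unchanged z _ z≢r ¬anc = sym (parent-other z≢r (λ z≡y → ¬anc (0 , sym z≡y)))

      fewer-bad : ∀ x → Bad tree x → Bad t x × x ≢ y
      fewer-bad x (x∈ , x≢rb , px≡ra) with x ≟ y
      ... | yes x≡y = ⊥-elim (rb≢ra rb≡ra)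
        where
        open ≡-Reasoning
        y≢r : y ≢ root s
        y≢r = subst (λ w → w ≢ root s) x≡y (b≢root x∈)
        rb≡ra : rb ≡ ra
        rb≡ra = begin
          rb            ≡⟨ sym (parent-x y≢r) ⟩
          parent tree y ≡⟨ cong (parent tree) (sym x≡y) ⟩
          parent tree x ≡⟨ px≡ra ⟩
          ra            ∎
      ... | no x≢y  = (x∈ , x≢rb , trans (sym (parent-other (b≢root x∈) x≢y)) px≡ra) , x≢y

  within : ∀ L {t} → t ⊑ s → (∀ x → Bad t x → x ∈ L) → UnionFindTree t
  within [] {t} R bad⊆[] =
    merge (IH-a (shortcutTree-⊑ a (parent t) (shortcut-a R)))
          (IH-b (shortcutTree-⊑ b (parent t) (shortcut-b R good)))
          b≤a (as-merge R good)
    where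
    good : ∀ x → ¬ Bad t x
    good x bad with bad⊆[] x bad
    ... | ()
  within (y ∷ L) {t} R bad⊆yL with bad? t y
  ... | no ¬bad-y = within L R bad⊆L
    where
    bad⊆L : ∀ x → Bad t x → x ∈ L
    bad⊆L x bad with bad⊆yL x bad
    ... | here x≡y = ⊥-elim (¬bad-y (subst (Bad t) x≡y bad))
    ... | there x∈ = x∈
  ... | yes bad-y = collapse (within L tree-⊑ bad⊆L) collapse-bad
    where
    open BadNode R bad-y
    bad⊆L : ∀ x → Bad tree x → x ∈ L
    bad⊆L x bad′ with fewer-bad x bad′
    ... | bad , x≢y with bad⊆yL x bad
    ...   | here x≡y = ⊥-elim (x≢y x≡y)
    ...   | there x∈ = x∈

  result : ∀ {t} → t ⊑ s → UnionFindTree t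
  result R = within (nodes b) R (λ _ bad → proj₁ bad)

shortcut-of-union : ∀ {s} → UnionTree s → ∀ {t} → t ⊑ s → UnionFindTree t
shortcut-of-union (one one-node) R = one (trans (⊑-size R) one-node)
shortcut-of-union (merge ua ub b≤a M) =
  MergeStep.result M b≤a (shortcut-of-union ua) (shortcut-of-union ub)

-- If a and b are below Union trees a′ and b′, their merge is below the
-- merge of a′ and b′, which is a Union tree as a′ and b′ have the same sizes
-- as a and b.
merge-below : ∀ {a b u a′ b′} → IsMerge a b u → size b ≤ size a →
              UnionTree a′ → UnionTree b′ → a ⊑ a′ → b ⊑ b′ → ∃ λ s → UnionTree s × u ⊑ s
merge-below {a′ = a′} {b′} M b≤a ua′ ub′ Ra Rb =
  merged , merge ua′ ub′ (subst₂ _≤_ (⊑-size Rb) (⊑-size Ra) b≤a) is-merge ,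
  ⊑-merge M is-merge Ra Rb
  where
  disjoint′ : ∀ x → x ∈ nodes a′ → x ∉ nodes b′
  disjoint′ x x∈a′ x∈b′ =
    IsMerge.disjoint M x (from (same-nodes Ra x) x∈a′) (from (same-nodes Rb x) x∈b′)
  open MergeConstruction a′ b′ disjoint′

below-union : ∀ {t} → UnionFindTree t → ∃ λ s → UnionTree s × t ⊑ s
below-union (one one-node) = _ , one one-node , ⊑-refl
below-union (merge uf-a uf-b b≤a M) with below-union uf-a | below-union uf-b
... | _ , ua′ , Ra | _ , ub′ , Rb = merge-below M b≤a ua′ ub′ Ra Rb
below-union (collapse uf C) with below-union uf
... | s , us , R = s , us , ⊑-collapse C R

sum-map-≤ : ∀ {g h : ℕ → ℕ} L → (∀ z → z ∈ L → g z ≤ h z) → sum (map g L) ≤ sum (map h L)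
sum-map-≤ []      _  = z≤n
sum-map-≤ (z ∷ L) le = +-mono-≤ (le z (here refl)) (sum-map-≤ L (λ w w∈ → le w (there w∈)))

sum-map-< : ∀ {g h : ℕ → ℕ} {x} L → (∀ z → z ∈ L → g z ≤ h z) → x ∈ L → g x < h x →
            sum (map g L) < sum (map h L)
sum-map-< (z ∷ L) le (here refl) lt = +-mono-<-≤ lt (sum-map-≤ L (λ w w∈ → le w (there w∈)))
sum-map-< (z ∷ L) le (there x∈) lt =
  +-mono-≤-< (le z (here refl)) (sum-map-< L (λ w w∈ → le w (there w∈)) x∈ lt)

module Weight {t s : Tree} (R : t ⊑ s) where

  gap : ℕ → ℕ
  gap z with z ∈? nodes s | z ≟ root s
  ... | yes z∈ | no z≢r = proj₁ (shortcut R z z∈ z≢r)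
  ... | _      | _      = 0

  gap-path : ∀ {z} → z ∈ nodes s → z ≢ root s → PathT s (gap z) (parent t z) z
  gap-path {z} z∈ z≢r with z ∈? nodes s | z ≟ root s
  ... | yes z∈′ | no z≢r′ = proj₂ (shortcut R z z∈′ z≢r′)
  ... | yes _   | yes z≡r = ⊥-elim (z≢r z≡r)
  ... | no z∉   | _       = ⊥-elim (z∉ z∈)

  gap-unique : ∀ {z n} → z ∈ nodes s → z ≢ root s → PathT s n (parent t z) z → gap z ≡ n
  gap-unique z∈ z≢r q = path-length-unique s (gap-path z∈ z≢r) q z∈

  gap-root : gap (root s) ≡ 0
  gap-root with root s ∈? nodes s | root s ≟ root s
  ... | yes _ | no r≢r = ⊥-elim (r≢r refl)
  ... | yes _ | yes _  = refl
  ... | no _  | _      = refl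

  weight : ℕ
  weight = sum (map gap (nodes s))

-- A node x and a t-sibling c of x lying on the s-path from x up to the
-- t-parent of x: pushing x to c brings x's parent closer to x.
record PushSite {t s : Tree} (R : t ⊑ s) : Set where
  field
    x c m n  : ℕ
    x∈       : x ∈ nodes s
    x≢root   : x ≢ root s
    c≢root   : c ≢ root s
    siblings : parent t c ≡ parent t x
    x→c      : PathT s m c x
    x→parent : PathT s n (parent t x) x
    m<n      : m < n

-- If some node x has a t-parent other than its s-parent, a push site exists:
-- let c be the node just below parent t x on the s-path from x; either c is
-- a t-sibling of x, or the t-parent of c again differs from its s-parent,
-- and we continue from c, which is higher up in s.
find-site : ∀ {t s} (R : t ⊑ s) {x} → x ∈ nodes s → x ≢ root s → parent t x ≢ parent s x →
            PushSite R
find-site {t} {s} R x∈ = go (⊏-acc s x∈) x∈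
  where
  go : ∀ {x} → Acc (StrictAnc s) x → x ∈ nodes s → x ≢ root s → parent t x ≢ parent s x →
       PushSite R
  go {x} (acc above) x∈ x≢r differs with shortcut R x x∈ x≢r
  ... | n , x→px with lastStep x→px
  ... | inj₁ same = ⊥-elim (differs same)
  ... | inj₂ (m , c , m<n , x→c , c≢r , pc≡px) with parent t c ≟ parent t x
  ... | yes siblings = record
    { x = x ; c = c ; m = m ; n = n ; x∈ = x∈ ; x≢root = x≢r ; c≢root = c≢r
    ; siblings = siblings ; x→c = x→c ; x→parent = x→px ; m<n = m<n }
  ... | no ¬siblings = go (above (m , x→c)) (path-end∈ s x→c x∈) c≢r
                          (λ pc≡ → ¬siblings (trans pc≡ pc≡px))

push-at : ∀ {t s} (R : t ⊑ s) → PushSite R →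
          ∃ λ t₁ → t ⊢ t₁ × Σ (t₁ ⊑ s) λ R₁ → Weight.weight R₁ < Weight.weight R
push-at {t} {s} R site = tree , (x , c , pushed) , tree-⊑ , lighter
  where
  open PushSite site
  open Redirect R x c (m , x→c)
  root-t : root t ≡ root s
  root-t = same-root R
  pushed : IsPush t x c tree
  pushed = record
    { x≢y = λ x≡c → acyclic s x∈ (m , subst (λ w → PathT s m w x) (sym x≡c) x→c)
    ; x∈ = from (same-nodes R x) x∈
    ; y∈ = from (same-nodes R c) (path-end∈ s x→c x∈)
    ; x≢root = λ x≡r → x≢root (trans x≡r root-t)
    ; y≢root = λ c≡r → c≢root (trans c≡r root-t)
    ; sibling = sym siblings
    ; nodes-u = λ z → mk⇔ (from (same-nodes R z)) (to (same-nodes R z))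
    ; root-u = sym root-t
    ; parent-x = parent-x x≢root
    ; parent-other = λ z _ z≢r z≢x → parent-other (λ z≡r → z≢r (trans z≡r (sym root-t))) z≢x }
  module W  = Weight R
  module W₁ = Weight tree-⊑
  at-x : W₁.gap x < W.gap x
  at-x = subst₂ _<_
    (sym (W₁.gap-unique x∈ x≢root (subst (λ w → PathT s m w x) (sym (parent-x x≢root)) x→c)))
    (sym (W.gap-unique x∈ x≢root x→parent)) m<n
  no-heavier : ∀ z → z ∈ nodes s → W₁.gap z ≤ W.gap z
  no-heavier z z∈ = by-cases (z ≟ root s) (z ≟ x)
    where
    by-cases : Dec (z ≡ root s) → Dec (z ≡ x) → W₁.gap z ≤ W.gap z
    by-cases (yes z≡r) _         = subst (λ w → W₁.gap w ≤ W.gap w) (sym z≡r)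
                                         (subst (_≤ W.gap (root s)) (sym W₁.gap-root) z≤n)
    by-cases (no _)    (yes z≡x) = subst (λ w → W₁.gap w ≤ W.gap w) (sym z≡x) (<⇒≤ at-x)
    by-cases (no z≢r)  (no z≢x)  = ≤-reflexive (W₁.gap-unique z∈ z≢r
      (subst (λ w → PathT s (W.gap z) w z) (sym (parent-other z≢r z≢x)) (W.gap-path z∈ z≢r)))
  lighter : W₁.weight < W.weight
  lighter = sum-map-< (nodes s) no-heavier x∈ at-x

agree-or-differ : ∀ t s →
  (∀ z → z ∈ nodes s → z ≢ root s → parent t z ≡ parent s z) ⊎
  (∃ λ z → z ∈ nodes s × z ≢ root s × parent t z ≢ parent s z)
agree-or-differ t s with any? (λ z → ¬? (z ≟ root s) ×-dec ¬? (parent t z ≟ parent s z)) (nodes s)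
... | yes some = inj₂ (find some)
... | no none  = inj₁ λ z z∈ z≢r →
  decidable-stable (parent t z ≟ parent s z) (λ differs → none (lose z∈ (z≢r , differs)))

record _≅_ (t s : Tree) : Set where
  field
    ≅-nodes  : ∀ z → z ∈ nodes t ⇔ z ∈ nodes s
    ≅-root   : root t ≡ root s
    ≅-parent : ∀ z → z ∈ nodes s → z ≢ root s → parent t z ≡ parent s z
open _≅_ public

push-to : ∀ {t s} → t ⊑ s → ∃ λ s′ → t ⊢* s′ × s′ ≅ s
push-to {s = s} R = go R (<-wellFounded _)
  where
  go : ∀ {t} (R : t ⊑ s) → Acc _<_ (Weight.weight R) → ∃ λ s′ → t ⊢* s′ × s′ ≅ s
  go {t} R (acc lighter) with agree-or-differ t s
  ... | inj₁ agree =
    t , ε , record { ≅-nodes = same-nodes R ; ≅-root = same-root R ; ≅-parent = agree }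
  ... | inj₂ (x , x∈ , x≢r , differs) with push-at R (find-site R x∈ x≢r differs)
  ...   | t₁ , push , R₁ , lt with go R₁ (lighter lt)
  ...     | s′ , pushes , s′≅s = s′ , push ◅ pushes , s′≅s

union-≅ : ∀ {s s′} → UnionTree s → s′ ≅ s → UnionTree s′
union-≅ {s} {s′} (one one-node) E = one (trans (⊑-size s′⊑s) one-node)
  where
  s′⊑s : s′ ⊑ s
  s′⊑s = record
    { same-nodes = ≅-nodes E ; same-root = ≅-root E
    ; shortcut   = λ z z∈ z≢r →
        1 , subst (λ p → PathT s 1 p z) (sym (≅-parent E z z∈ z≢r)) (step z≢r) }
union-≅ (merge {s = b} ua ub b≤a M) E = merge ua ub b≤a (record
  { disjoint  = disjoint
  ; nodes-u   = λ x → mk⇔ (λ x∈ → to (nodes-u x) (to (≅-nodes E x) x∈))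
                          (λ x∈ → from (≅-nodes E x) (from (nodes-u x) x∈))
  ; root-u    = trans (≅-root E) root-u
  ; parent-rs = trans (≅-parent E (root b) (inB (root∈ b)) (b≢root (root∈ b))) parent-rs
  ; parent-t  = λ x x∈ x≢ra → trans (≅-parent E x (inA x∈) (λ x≡r → x≢ra (trans x≡r root-u)))
                                    (parent-t x x∈ x≢ra)
  ; parent-s  = λ x x∈ x≢rb → trans (≅-parent E x (inB x∈) (b≢root x∈)) (parent-s x x∈ x≢rb) })
  where
  open IsMerge M
  open MergePaths M

theorem2 : ∀ (t : Tree) → UnionFindTree t ⇔ (∃ λ s → t ⊢* s × UnionTree s)
theorem2 t = mk⇔ pushes-to-union from-union
  where
  pushes-to-union : UnionFindTree t → ∃ λ s → t ⊢* s × UnionTree s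
  pushes-to-union uf with below-union uf
  ... | s , union-s , t⊑s with push-to t⊑s
  ...   | s′ , pushes , s′≅s = s′ , pushes , union-≅ union-s s′≅s
  from-union : (∃ λ s → t ⊢* s × UnionTree s) → UnionFindTree t
  from-union (s , pushes , union-s) = shortcut-of-union union-s (⊢*-⊑ pushes ⊑-refl)
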